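{- Let $G=(V,E)$ be a graph with a weight function $w:V\to\mathbb{N}^+$, and let $\mathcal{P}=\{p_1,\dots,p_\ell\}$ be a set of $\ell$ restricted $P_4$'s in $G$ such that every vertex $v\in V$ is contained in at most $w(v)$ of the paths in $\mathcal{P}$. Then every 2-club vertex deletion set $S$ of $G$ satisfies $w(S)\ge\ell$.
   Context: All graphs are finite, simple and undirected. A 2-club is a graph of diameter at most two; a 2-club cluster graph is a graph each of whose connected components is a 2-club. A restricted $P_4$ in $G$ is a path $stuv$ on distinct vertices with $\{s,t\},\{t,u\},\{u,v\}\in E$ and $\mathrm{dist}_G(s,v)=3$. A 2-club vertex deletion set of $G$ is a set $S\subseteq V$ such that $G[V\setminus S]$ is a 2-club cluster graph. $w(S)=\sum_{v\in S}w(v)$. -}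

module Defs where

open import Data.Nat using (ℕ; zero; suc; _+_; _≤_)
open import Data.Fin using (Fin)
open import Data.Fin.Properties using (_≟_)
open import Data.Fin.Subset using (Subset; _∈_; _∉_)
open import Data.Fin.Subset.Properties using (_∈?_)
open import Data.List using (List; []; _∷_; length; filter; allFin; map)
open import Data.Nat.ListAction using (sum)
open import Data.List.Relation.Unary.All using (All)
open import Data.Product using (Σ; _×_; _,_; ∃-syntax)
open import Data.Sum using (_⊎_)
open import Relation.Binary.PropositionalEquality using (_≡_)
open import Relation.Nullary using (¬_; Dec; yes; no; does)
open import Data.Bool using (if_then_else_)
open import Relation.Nullary.Decidable using (_⊎-dec_)

record Graph (n : ℕ) : Set₁ where
  field
    Adj   : Fin n → Fin n → Set
    sym   : ∀ {x y} → Adj x y → Adj y x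
    irrefl : ∀ {x} → ¬ Adj x x
open Graph public

module _ {n : ℕ} (G : Graph n) where

  DistLe2 : Fin n → Fin n → Set
  DistLe2 x y = x ≡ y ⊎ Adj G x y ⊎ (∃[ z ] (Adj G x z × Adj G z y))

  data ReachAvoid (S : Subset n) : Fin n → Fin n → Set where
    here : ∀ {x} → x ∉ S → ReachAvoid S x x
    step : ∀ {x y z} → x ∉ S → Adj G x y → ReachAvoid S y z → ReachAvoid S x z

  DistLe2Avoid : Subset n → Fin n → Fin n → Set
  DistLe2Avoid S x y = x ≡ y ⊎ Adj G x y ⊎ (∃[ z ] (z ∉ S × Adj G x z × Adj G z y))

  -- G[V \ S] is a 2-club cluster graph: each connected component has diameter ≤ 2
  Is2ClubDeletionSet : Subset n → Set
  Is2ClubDeletionSet S = ∀ x y → x ∉ S → y ∉ S → ReachAvoid S x y → DistLe2Avoid S x y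

  record RestrictedP4 : Set where
    constructor p4
    field
      s t u v : Fin n
      st : Adj G s t
      tu : Adj G t u
      uv : Adj G u v
      s≢t : ¬ s ≡ t
      s≢u : ¬ s ≡ u
      s≢v : ¬ s ≡ v
      t≢u : ¬ t ≡ u
      t≢v : ¬ t ≡ v
      u≢v : ¬ u ≡ v
      -- dist_G(s,v) = 3 (given the path stuv, dist ≤ 3 holds, so = 3 iff not ≤ 2)
      far : ¬ DistLe2 s v
  open RestrictedP4 public

OnPath : ∀ {n} {G : Graph n} → Fin n → RestrictedP4 G → Set
OnPath x p = x ≡ s p ⊎ x ≡ t p ⊎ x ≡ u p ⊎ x ≡ v p

onPath? : ∀ {n} {G : Graph n} (x : Fin n) (p : RestrictedP4 G) → Dec (OnPath x p)
onPath? x p = (x ≟ s p) ⊎-dec ((x ≟ t p) ⊎-dec ((x ≟ u p) ⊎-dec (x ≟ v p)))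

countContaining : ∀ {n} {G : Graph n} → Fin n → List (RestrictedP4 G) → ℕ
countContaining x ps = length (filter (onPath? x) ps)

SameP4 : ∀ {n} {G : Graph n} → RestrictedP4 G → RestrictedP4 G → Set
SameP4 p q = (s p ≡ s q × t p ≡ t q × u p ≡ u q × v p ≡ v q)
           ⊎ (s p ≡ v q × t p ≡ u q × u p ≡ t q × v p ≡ s q)

-- the paths in the list are pairwise distinct (the family is a set)
data Distinct {n} {G : Graph n} : List (RestrictedP4 G) → Set where
  []  : Distinct []
  _∷_ : ∀ {p ps} → All (λ q → ¬ SameP4 p q) ps → Distinct ps → Distinct (p ∷ ps)

weightOf : ∀ {n} → (Fin n → ℕ) → Subset n → ℕ
weightOf {n} w S = sum (map (λ x → if does (x ∈? S) then w x else 0) (allFin n))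

module Submission where

open import Defs
open import Data.Nat using (ℕ; _≤_; _<_; _+_; suc; z≤n; s≤s)
open import Data.Nat.Properties
  using (≤-refl; ≤-trans; n≤1+n; +-mono-≤; +-mono-<-≤; +-mono-≤-<; module ≤-Reasoning)
open import Data.Nat.ListAction using (sum)
open import Data.Bool using (if_then_else_; true; false)
open import Data.Fin using (Fin)
open import Data.Fin.Subset using (Subset; _∈_)
open import Data.Fin.Subset.Properties using (_∈?_)
open import Data.List using (List; []; _∷_; length; map; filter; allFin)
open import Data.List.Properties using (filter-accept)
open import Data.List.Relation.Unary.All as All using (All; []; _∷_)
open import Data.List.Relation.Unary.Any as Any using (Any; here; there)
open import Data.List.Membership.Propositional using (lose)
open import Data.List.Membership.Propositional.Properties using (∈-allFin; ∈-filter⁺)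
open import Data.Product using (_×_; _,_; ∃-syntax)
open import Data.Sum using (inj₁; inj₂)
open import Data.Empty using (⊥-elim)
open import Relation.Nullary using (yes; no; does)
open import Relation.Unary using (Decidable)
open import Relation.Binary.PropositionalEquality using (_≡_; refl; cong)

-- Every restricted P4 meets every 2-club vertex deletion set S: if it avoided S,
-- it would be a walk in G[V ∖ S], so its ends would be at distance ≤ 2 there and
-- hence in G. Counting, with multiplicity, the deleted of S lying on the paths
-- of the family therefore gives at least ℓ, while the packing condition bounds
-- the contribution of each x ∈ S by w(x).

module _ {A : Set} where

  sum-map-mono-≤ : {f g : A → ℕ} → (∀ x → f x ≤ g x) →
                   (xs : List A) → sum (map f xs) ≤ sum (map g xs)
  sum-map-mono-≤ f≤g []       = z≤n
  sum-map-mono-≤ f≤g (x ∷ xs) = +-mono-≤ (f≤g x) (sum-map-mono-≤ f≤g xs)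

  sum-map-mono-< : {f g : A → ℕ} → (∀ x → f x ≤ g x) →
                   {xs : List A} → Any (λ x → f x < g x) xs →
                   sum (map f xs) < sum (map g xs)
  sum-map-mono-< f≤g {x ∷ xs} (here fx<gx) = +-mono-<-≤ fx<gx (sum-map-mono-≤ f≤g xs)
  sum-map-mono-< f≤g {x ∷ xs} (there any)  = +-mono-≤-< (f≤g x) (sum-map-mono-< f≤g any)

  module _ {P : A → Set} (P? : Decidable P) where

    sum-map-filter : (f : A → ℕ) (xs : List A) →
                     sum (map f (filter P? xs)) ≡
                     sum (map (λ x → if does (P? x) then f x else 0) xs)
    sum-map-filter f []       = refl
    sum-map-filter f (x ∷ xs) with does (P? x)
    ... | true  = cong (f x +_) (sum-map-filter f xs)
    ... | false = sum-map-filter f xs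

    length-filter-≤-∷ : ∀ a as → length (filter P? as) ≤ length (filter P? (a ∷ as))
    length-filter-≤-∷ a as with does (P? a)
    ... | true  = n≤1+n _
    ... | false = ≤-refl

    length-filter-<-∷ : ∀ {a} as → P a → length (filter P? as) < length (filter P? (a ∷ as))
    length-filter-<-∷ as pa rewrite filter-accept P? {xs = as} pa = ≤-refl

length≤sum-multiplicity : {A B : Set} {R : A → B → Set} (R? : ∀ x → Decidable (R x))
                          (xs : List A) (ps : List B) → All (λ p → Any (λ x → R x p) xs) ps →
                          length ps ≤ sum (map (λ x → length (filter (R? x) ps)) xs)
length≤sum-multiplicity R? xs []       []                = z≤n
length≤sum-multiplicity R? xs (p ∷ ps) (covered ∷ cover) =
  ≤-trans (s≤s (length≤sum-multiplicity R? xs ps cover))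
          (sum-map-mono-< (λ x → length-filter-≤-∷ (R? x) p ps)
                          (Any.map (length-filter-<-∷ (R? _) ps) covered))

module _ {n : ℕ} {G : Graph n} {S : Subset n} where

  DistLe2Avoid⇒DistLe2 : ∀ {x y} → DistLe2Avoid G S x y → DistLe2 G x y
  DistLe2Avoid⇒DistLe2 (inj₁ x≡y)                      = inj₁ x≡y
  DistLe2Avoid⇒DistLe2 (inj₂ (inj₁ xy))                = inj₂ (inj₁ xy)
  DistLe2Avoid⇒DistLe2 (inj₂ (inj₂ (z , _ , xz , zy))) = inj₂ (inj₂ (z , xz , zy))

  restrictedP4-meets-deletionSet : Is2ClubDeletionSet G S →
                                   (p : RestrictedP4 G) → ∃[ x ] (x ∈ S × OnPath x p)
  restrictedP4-meets-deletionSet deletion p with s p ∈? S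
  ... | yes s∈S = s p , s∈S , inj₁ refl
  ... | no s∉S with t p ∈? S
  ... | yes t∈S = t p , t∈S , inj₂ (inj₁ refl)
  ... | no t∉S with u p ∈? S
  ... | yes u∈S = u p , u∈S , inj₂ (inj₂ (inj₁ refl))
  ... | no u∉S with v p ∈? S
  ... | yes v∈S = v p , v∈S , inj₂ (inj₂ (inj₂ refl))
  ... | no v∉S  = ⊥-elim (far p (DistLe2Avoid⇒DistLe2 (deletion (s p) (v p) s∉S v∉S walk)))
    where
    walk : ReachAvoid G S (s p) (v p)
    walk = step s∉S (st p) (step t∉S (tu p) (step u∉S (uv p) (here v∉S)))

mainTheorem8 : ∀ {n} (G : Graph n) (w : Fin n → ℕ) → (∀ x → 0 < w x)
    → (P : List (RestrictedP4 G)) → Distinct P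
    → (∀ x → countContaining x P ≤ w x)
    → (S : Subset n) → Is2ClubDeletionSet G S
    → length P ≤ weightOf w S
mainTheorem8 {n} G w _ P _ packing S deletion = begin
  length P                                      ≤⟨ length≤sum-multiplicity onPath? deleted P cover ⟩
  sum (map (λ x → countContaining x P) deleted) ≤⟨ sum-map-mono-≤ packing deleted ⟩
  sum (map w deleted)                           ≡⟨ sum-map-filter (_∈? S) w (allFin n) ⟩
  weightOf w S                                  ∎
  where
  open ≤-Reasoning
  deleted : List (Fin n)
  deleted = filter (_∈? S) (allFin n)
  cover : All (λ p → Any (λ x → OnPath x p) deleted) P
  cover = All.tabulate λ {p} _ → hitting p (restrictedP4-meets-deletionSet deletion p)
    where
    hitting : ∀ p → ∃[ x ] (x ∈ S × OnPath x p) → Any (λ x → OnPath x p) deleted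
    hitting p (x , x∈S , onPath) = lose (∈-filter⁺ (_∈? S) (∈-allFin x) x∈S) onPath
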